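{- Let $s\geqslant 2$ and let $t$ be a positive integer coprime to $s$. Then: (1) the level $t$ actions $\psi_t$ and $\chi_t$ of the affine symmetric group $\hat{\mathfrak{S}}_s$ on the set of alcoves commute, i.e. $\psi_t(\sigma)\bigl(\chi_t(\tau)(\mathcal{B})\bigr)=\chi_t(\tau)\bigl(\psi_t(\sigma)(\mathcal{B})\bigr)$ for all $\sigma,\tau\in\hat{\mathfrak{S}}_s$ and every alcove $\mathcal{B}$; (2) if $t=1$, then for each $i\in\{0,\dots,s-1\}$ we have $\psi_1(\sigma_i)(\mathtt{A})=\chi_1(\sigma_i)(\mathtt{A})$, where $\mathtt{A}$ is the fundamental alcove.
   Context: Let $P^s=\{p\in\mathbb{R}^s : p_1+\dots+p_s=\binom s2\}$. For $1\leqslant i\neq j\leqslant s$ and $k\in\mathbb{Z}$ let $H_{ij}^k=\{p\in P^s: p_j-p_i=ks\}$, and let $\mathcal{H}=\{H_{ij}^k: 1\leqslant i<j\leqslant s,\ k\in\mathbb{Z}\}$. Alcoves are the connected components of the complement in $P^s$ of the union of the hyperplanes in $\mathcal{H}$. The origin is the point $(0,1,\dots,s-1)$, and the fundamental alcove $\mathtt{A}$ is the alcove containing it. An $s$-point is a point of $P^s$ whose coordinates are integers pairwise incongruent modulo $s$; each alcove contains exactly one $s$-point, which identifies alcoves with $s$-points. For $i\neq j$ and $k\in\mathbb{Z}$, $r_{ij}^k$ denotes the orthogonal reflection $p\mapsto p-(p_j-p_i-ks)(\mathbf{e}_j-\mathbf{e}_i)$ in $H_{ij}^k$. The affine symmetric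 group $\hat{\mathfrak{S}}_s$ has generators $\sigma_0,\dots,\sigma_{s-1}$ and relations $\sigma_i^2=1$; $\sigma_i\sigma_j=\sigma_j\sigma_i$ for $i\not\equiv j\pm1\pmod s$; $\sigma_i\sigma_j\sigma_i=\sigma_j\sigma_i\sigma_j$ for $i\equiv j+1\not\equiv j-1\pmod s$. The action $\psi_t$ sends $\sigma_i\mapsto r_{i(i+1)}^0$ for $1\leqslant i\leqslant s-1$ and $\sigma_0\mapsto r_{1s}^t$; explicitly $\psi_t(\sigma_i)$ swaps coordinates $i,i+1$, and $\psi_t(\sigma_0)(p_1,\dots,p_s)=(p_s-st,p_2,\dots,p_{s-1},p_1+st)$. It acts on $P^s$, preserving alcoves and $s$-points. The action $\chi_t$ (for $\gcd(s,t)=1$) on $s$-points: given an $s$-point $p$ and $i\in\{0,\dots,s-1\}$, let $j,k\in\{1,\dots,s\}$ be such that $p_j\equiv (i-1)t$ and $p_k\equiv it\pmod s$; then $\chi_t(\sigma_i)(p)$ is obtained from $p$ by replacing $p_j$ by $p_j+t$ and $p_k$ by $p_k-t$. Via the bijection between alcoves and $s$-points this is regarded as an action on alcoves. -}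

module Defs where

open import Data.Nat as ℕ using (ℕ; zero; suc)
import Data.Nat.Divisibility as ℕD
open import Data.Integer as ℤ using (ℤ; +_; _+_; _-_; _*_; ∣_∣)
open import Data.Integer.Divisibility using (_∣_)
open import Data.Fin using (Fin; zero; suc; toℕ; inject₁; fromℕ)
open import Data.Fin.Properties using (any?)
open import Data.Vec using (Vec; lookup; _[_]≔_; foldr′; tabulate)
open import Data.List using (List; []; _∷_)
open import Data.Product using (_×_; ∃; _,_)
open import Relation.Nullary using (¬_; Dec; yes; no)
open import Relation.Binary.PropositionalEquality using (_≡_)

-- Points of ℝ^s with integer coordinates; coordinate number c (1-based in
-- the paper) is stored at position c-1 : Fin s.
Point : ℕ → Set
Point s = Vec ℤ s

_≡_[mod_] : ℤ → ℤ → ℕ → Set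
a ≡ b [mod s ] = (+ s) ∣ (a - b)

congr? : (a b : ℤ) (s : ℕ) → Dec (a ≡ b [mod s ])
congr? a b s = s ℕD.∣? ∣ a - b ∣

sumℤ : ∀ {s} → Vec ℤ s → ℤ
sumℤ = foldr′ _+_ (+ 0)

choose2 : ℕ → ℕ
choose2 zero = 0
choose2 (suc n) = n ℕ.+ choose2 n

-- s-point: lies in P^s (coordinate sum = binom s 2) and coordinates are
-- pairwise incongruent modulo s.  Alcoves are identified with s-points.
IsSPoint : (s : ℕ) → Point s → Set
IsSPoint s p = (sumℤ p ≡ + choose2 s)
             × (∀ (a b : Fin s) → ¬ a ≡ b → ¬ (lookup p a ≡ lookup p b [mod s ]))

-- the origin (0,1,...,s-1): the s-point of the fundamental alcove A
origin : (s : ℕ) → Point s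
origin s = tabulate (λ a → + toℕ a)

swap : ∀ {s} → Fin s → Fin s → Point s → Point s
swap a b p = (p [ a ]≔ lookup p b) [ b ]≔ lookup p a

psiGen : (s t : ℕ) → Fin s → Point s → Point s
psiGen (suc n) t zero p =
  (p [ zero ]≔ (lookup p (fromℕ n) - (+ (suc n) * + t)))
     [ fromℕ n ]≔ (lookup p zero + (+ (suc n) * + t))
psiGen (suc n) t (suc i) p = swap (inject₁ i) (suc i) p

findCoord : (s : ℕ) (p : Point s) (c : ℤ) → Dec (∃ λ (j : Fin s) → lookup p j ≡ c [mod s ])
findCoord s p c = any? (λ j → congr? (lookup p j) c s)

-- χ_t(σ_i): with p_j ≡ (i-1)t and p_k ≡ it (mod s), replace
-- p_j by p_j + t and p_k by p_k - t.  (On non-s-points, where such indices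
-- need not exist, it is the identity; only s-points matter.)
chiGen : (s t : ℕ) → Fin s → Point s → Point s
chiGen s t i p with findCoord s p ((+ toℕ i - + 1) * + t)
                  | findCoord s p (+ toℕ i * + t)
... | yes (j , _) | yes (k , _) = (p [ j ]≔ (lookup p j + + t)) [ k ]≔ (lookup p k - + t)
... | _ | _ = p

-- Elements of the affine symmetric group are represented by words in the
-- generators σ_0,…,σ_{s-1}; the word i₁ ∷ … ∷ iₘ stands for σ_{i₁}⋯σ_{iₘ}.
Word : ℕ → Set
Word s = List (Fin s)

act : ∀ {s} → (Fin s → Point s → Point s) → Word s → Point s → Point s
act g [] p = p
act g (i ∷ w) p = g i (act g w p)

psi : (s t : ℕ) → Word s → Point s → Point s
psi s t = act (psiGen s t)

chi : (s t : ℕ) → Word s → Point s → Point s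
chi s t = act (chiGen s t)

module Submission where

-- Both actions are generated by maps of a very special shape.
--  * Each ψ_t(σ_g) is a "rearrangement": the coordinate at position a of the
--    image is the coordinate at position π(a) of the argument, shifted by a
--    multiple of s, for a permutation π of the positions independent of the
--    point.  (For s ≥ 2 every ψ-generator is a transposition with shifts.)
--  * On a point with pairwise incongruent coordinates, χ_t(σ_i) either does
--    nothing (when one of the residues c₁ = (i-1)t, c₂ = it is absent) or
--    applies coordinatewise the map  step : x ↦ x - t (x ≡ c₂), x + t (x ≡ c₁),
--    x (otherwise); step commutes with shifts by multiples of s and is
--    injective modulo s.
-- A rearrangement preserves the set of residues of a point and commutes
-- with any coordinatewise map that commutes with shifts by multiples of s;
-- hence every ψ-generator commutes with every χ-generator on points with
-- incongruent coordinates.  Both kinds of generators preserve that property,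
-- so commutation extends to words.  Part (2) is a direct computation at the
-- origin (0,1,…,s-1).

open import Defs
open import Data.Nat using (ℕ; _≤_; zero; suc)
import Data.Nat as ℕ
import Data.Nat.Properties as ℕP
import Data.Nat.Divisibility as ℕD
open import Data.Nat.Coprimality using (Coprime)
open import Data.Nat.DivMod using (m<n⇒m%n≡m)
open import Data.Integer using (ℤ; +_; -_; _+_; _-_; _*_; ∣_∣)
import Data.Integer.Properties as ℤP
import Data.Integer.Divisibility.Signed as DS
open import Data.Integer.Tactic.RingSolver using (solve-∀)
open import Algebra.Properties.CommutativeSemigroup ℤP.+-commutativeSemigroup
  using (xy∙z≈xz∙y)
open import Data.Fin using (Fin; toℕ; inject₁; fromℕ) renaming (_≟_ to _≟F_)
import Data.Fin.Properties as FP
open import Data.Fin.Permutation using (Permutation′; _⟨$⟩ʳ_; _⟨$⟩ˡ_; inverseˡ; inverseʳ)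
import Data.Fin.Permutation as Perm
import Data.Fin.Permutation.Components as PC
open import Data.Vec using (Vec; lookup; _[_]≔_; tabulate)
open import Data.Vec.Properties
  using (lookup∘update; lookup∘update′; []≔-commutes; lookup∘tabulate; tabulate∘lookup; tabulate-cong)
open import Data.List using ([]; _∷_)
open import Data.Product using (_×_; ∃; _,_)
open import Data.Sum using (_⊎_; inj₁; inj₂)
open import Data.Bool using (true; false)
open import Data.Empty using (⊥-elim)
open import Function using (_∘_)
open import Relation.Nullary using (¬_; Dec; yes; no; does)
open import Relation.Nullary.Decidable using (map′; _×-dec_)
open import Relation.Binary.PropositionalEquality
  using (_≡_; refl; sym; trans; cong; cong₂; subst; subst₂; _≢_; module ≡-Reasoning)

lookup-ext : ∀ {A : Set} {n} (xs ys : Vec A n) → (∀ a → lookup xs a ≡ lookup ys a) → xs ≡ ys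
lookup-ext xs ys h = trans (sym (tabulate∘lookup xs)) (trans (tabulate-cong h) (tabulate∘lookup ys))

module Words {s : ℕ} (P : Point s → Set) where

  Preserves : (Fin s → Point s → Point s) → Set
  Preserves g = ∀ i p → P p → P (g i p)

  act-preserves : ∀ {g} → Preserves g → ∀ w p → P p → P (act g w p)
  act-preserves g-P []      p Pp = Pp
  act-preserves g-P (i ∷ w) p Pp = g-P i (act _ w p) (act-preserves g-P w p Pp)

  act-commute : ∀ {g h} → Preserves g → Preserves h →
                (∀ i j p → P p → g i (h j p) ≡ h j (g i p)) →
                ∀ σ τ p → P p → act g σ (act h τ p) ≡ act h τ (act g σ p)
  act-commute {g} {h} g-P h-P gh σ τ p Pp = words σ p Pp
    where
    letter : ∀ i τ p → P p → g i (act h τ p) ≡ act h τ (g i p)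
    letter i []      p Pp = refl
    letter i (j ∷ τ) p Pp = trans (gh i j (act h τ p) (act-preserves h-P τ p Pp))
                                  (cong (h j) (letter i τ p Pp))

    words : ∀ σ p → P p → act g σ (act h τ p) ≡ act h τ (act g σ p)
    words []      p Pp = refl
    words (i ∷ σ) p Pp = trans (cong (g i) (words σ p Pp))
                               (letter i τ (act g σ p) (act-preserves g-P σ p Pp))

-- Congruence modulo s, wrapped in a record so that both sides can be
-- inferred (the underlying relation only mentions |a - b|).
module Congruence (s : ℕ) where

  infix 4 _≈_ _≈?_
  record _≈_ (a b : ℤ) : Set where
    constructor ⟦_⟧
    field unwrap : a ≡ b [mod s ]
  open _≈_ public

  private
    fromSigned : ∀ {a b} → + s DS.∣ a - b → a ≈ b
    fromSigned h = ⟦ DS.∣⇒∣ᵤ h ⟧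

    toSigned : ∀ {a b} → a ≈ b → + s DS.∣ a - b
    toSigned h = DS.∣ᵤ⇒∣ (unwrap h)

    +-cancel : ∀ a b k → (a + k) - (b + k) ≡ a - b
    +-cancel = solve-∀

    add-sub : ∀ x d → (x + d) - x ≡ d
    add-sub = solve-∀

  _≈?_ : ∀ a b → Dec (a ≈ b)
  a ≈? b = map′ ⟦_⟧ unwrap (congr? a b s)

  ≈-refl : ∀ {a} → a ≈ a
  ≈-refl {a} = ⟦ subst (λ z → s ℕD.∣ ∣ z ∣) (sym (ℤP.+-inverseʳ a)) (s ℕD.∣0) ⟧

  ≈-reflexive : ∀ {a b} → a ≡ b → a ≈ b
  ≈-reflexive refl = ≈-refl

  ≈-sym : ∀ {a b} → a ≈ b → b ≈ a
  ≈-sym {a} {b} h = ⟦ subst (s ℕD.∣_) (ℤP.∣i-j∣≡∣j-i∣ a b) (unwrap h) ⟧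

  ≈-trans : ∀ {a b c} → a ≈ b → b ≈ c → a ≈ c
  ≈-trans {a} {b} {c} h k = fromSigned
    (subst (+ s DS.∣_) (ℤP.+-minus-telescope a b c) (DS.∣m∣n⇒∣m+n (toSigned h) (toSigned k)))

  ≈-+ : ∀ {a b} k → a ≈ b → a + k ≈ b + k
  ≈-+ {a} {b} k h = ⟦ subst (λ z → s ℕD.∣ ∣ z ∣) (sym (+-cancel a b k)) (unwrap h) ⟧

  shift-≈ : ∀ x {d} → + s DS.∣ d → x + d ≈ x
  shift-≈ x {d} h = fromSigned (subst (+ s DS.∣_) (sym (add-sub x d)) h)

module Residues (s : ℕ) where
  open Congruence s

  Distinct : Point s → Set
  Distinct p = ∀ a b → lookup p a ≈ lookup p b → a ≡ b

  HasResidue : Point s → ℤ → Set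
  HasResidue p c = ∃ λ j → lookup p j ≡ c [mod s ]

  spoint-distinct : ∀ p → IsSPoint s p → Distinct p
  spoint-distinct p (_ , incongruent) a b h with a ≟F b
  ... | yes a≡b = a≡b
  ... | no a≢b = ⊥-elim (incongruent a b a≢b (unwrap h))

module Rearrangements (s : ℕ) where
  open Congruence s
  open Residues s

  record Rearrangement (f : Point s → Point s) : Set where
    field
      perm   : Permutation′ s
      offset : Fin s → ℤ
      offset-divisible : ∀ a → + s DS.∣ offset a
      lookup-image : ∀ q a → lookup (f q) a ≡ lookup q (perm ⟨$⟩ʳ a) + offset a

  rearrangement-cong : ∀ {f g} → (∀ q → f q ≡ g q) → Rearrangement g → Rearrangement f
  rearrangement-cong f≗g R = record
    { perm = perm ; offset = offset ; offset-divisible = offset-divisible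
    ; lookup-image = λ q a → trans (cong (λ v → lookup v a) (f≗g q)) (lookup-image q a) }
    where open Rearrangement R

  module _ {f : Point s → Point s} (R : Rearrangement f) where
    open Rearrangement R

    image-≈ : ∀ q a → lookup (f q) a ≈ lookup q (perm ⟨$⟩ʳ a)
    image-≈ q a = subst (_≈ _) (sym (lookup-image q a)) (shift-≈ _ (offset-divisible a))

    preserves-distinct : ∀ q → Distinct q → Distinct (f q)
    preserves-distinct q dist a b h = begin
      a                         ≡⟨ inverseˡ perm ⟨
      perm ⟨$⟩ˡ (perm ⟨$⟩ʳ a)   ≡⟨ cong (perm ⟨$⟩ˡ_) (dist _ _ sources-≈) ⟩
      perm ⟨$⟩ˡ (perm ⟨$⟩ʳ b)   ≡⟨ inverseˡ perm ⟩
      b                         ∎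
      where
      open ≡-Reasoning
      sources-≈ : lookup q (perm ⟨$⟩ʳ a) ≈ lookup q (perm ⟨$⟩ʳ b)
      sources-≈ = ≈-trans (≈-sym (image-≈ q a)) (≈-trans h (image-≈ q b))

    residue-image : ∀ q c → HasResidue q c → HasResidue (f q) c
    residue-image q c (j , qj) = perm ⟨$⟩ˡ j ,
      unwrap (≈-trans (image-≈ q _) (subst (λ x → lookup q x ≈ c) (sym (inverseʳ perm)) ⟦ qj ⟧))

    residue-source : ∀ q c → HasResidue (f q) c → HasResidue q c
    residue-source q c (j , fqj) = perm ⟨$⟩ʳ j , unwrap (≈-trans (≈-sym (image-≈ q j)) ⟦ fqj ⟧)

    commutes-pointwise : (G : ℤ → ℤ) → (∀ x {d} → + s DS.∣ d → G (x + d) ≡ G x + d) →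
      ∀ q q' → (∀ a → lookup q' a ≡ G (lookup q a)) →
      ∀ a → lookup (f q') a ≡ G (lookup (f q) a)
    commutes-pointwise G G-shift q q' q'≡Gq a = begin
      lookup (f q') a                           ≡⟨ lookup-image q' a ⟩
      lookup q' (perm ⟨$⟩ʳ a) + offset a        ≡⟨ cong (_+ offset a) (q'≡Gq _) ⟩
      G (lookup q (perm ⟨$⟩ʳ a)) + offset a     ≡⟨ G-shift _ (offset-divisible a) ⟨
      G (lookup q (perm ⟨$⟩ʳ a) + offset a)     ≡⟨ cong G (lookup-image q a) ⟨
      G (lookup (f q) a)                        ∎
      where open ≡-Reasoning

module Exchange (s : ℕ) where
  open Rearrangements s

  exchange : Fin s → Fin s → ℤ → Point s → Point s
  exchange a b d p = (p [ a ]≔ (lookup p b - d)) [ b ]≔ (lookup p a + d)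

  -- the shift received by position c (defined by the same case split as
  -- the transposition of a and b)
  exchange-offset : Fin s → Fin s → ℤ → Fin s → ℤ
  exchange-offset a b d c with does (c ≟F a)
  ... | true = - d
  ... | false with does (c ≟F b)
  ...   | true  = d
  ...   | false = + 0

  exchange-lookup : ∀ {a b} d → a ≢ b → ∀ q c →
    lookup (exchange a b d q) c ≡ lookup q (PC.transpose a b c) + exchange-offset a b d c
  exchange-lookup {a} {b} d a≢b q c with c ≟F a
  ... | yes refl = trans (lookup∘update′ a≢b (q [ a ]≔ (lookup q b - d)) _) (lookup∘update a q _)
  ... | no c≢a with c ≟F b
  ...   | yes refl = lookup∘update b (q [ a ]≔ (lookup q b - d)) _
  ...   | no c≢b = trans (lookup∘update′ c≢b (q [ a ]≔ (lookup q b - d)) _)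
                   (trans (lookup∘update′ c≢a q _) (sym (ℤP.+-identityʳ _)))

  exchange-rearrangement : ∀ {a b d} → a ≢ b → + s DS.∣ d → Rearrangement (exchange a b d)
  exchange-rearrangement {a} {b} {d} a≢b s∣d = record
    { perm = Perm.transpose a b
    ; offset = exchange-offset a b d
    ; offset-divisible = divisible
    ; lookup-image = exchange-lookup d a≢b }
    where
    divisible : ∀ c → + s DS.∣ exchange-offset a b d c
    divisible c with does (c ≟F a)
    ... | true = DS.∣m⇒∣-m s∣d
    ... | false with does (c ≟F b)
    ...   | true  = s∣d
    ...   | false = DS.divides (+ 0) refl

  swap-exchange : ∀ a b p → swap a b p ≡ exchange a b (+ 0) p
  swap-exchange a b p = cong₂ (λ u v → (p [ a ]≔ u) [ b ]≔ v)
    (sym (ℤP.+-identityʳ _)) (sym (ℤP.+-identityʳ _))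

inject₁≢suc : ∀ {n} (i : Fin n) → inject₁ i ≢ Fin.suc i
inject₁≢suc Fin.zero    ()
inject₁≢suc (Fin.suc i) e = inject₁≢suc i (FP.suc-injective e)

psiGen-rearrangement : ∀ m t (g : Fin (suc (suc m))) →
  Rearrangements.Rearrangement (suc (suc m)) (psiGen (suc (suc m)) t g)
psiGen-rearrangement m t Fin.zero =
  exchange-rearrangement (λ ()) (DS.∣m⇒∣m*n (+ t) DS.∣-refl)
  where open Exchange (suc (suc m))
psiGen-rearrangement m t (Fin.suc i) =
  rearrangement-cong (swap-exchange (inject₁ i) (Fin.suc i))
    (exchange-rearrangement (inject₁≢suc i) (DS.divides (+ 0) refl))
  where open Exchange (suc (suc m)); open Rearrangements (suc (suc m))

module ChiGenerator (s t : ℕ) (i : Fin s) where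
  open Congruence s
  open Residues s

  c₁ c₂ : ℤ
  c₁ = (+ toℕ i - + 1) * + t
  c₂ = + toℕ i * + t

  private
    sub-mul : ∀ I T → I * T - T ≡ (I - + 1) * T
    sub-mul = solve-∀

    add-mul : ∀ I T → (I - + 1) * T + T ≡ I * T
    add-mul = solve-∀

  -- since c₁ + t = c₂, subtracting t maps the class of c₂ to that of c₁,
  -- and adding t maps the class of c₁ to that of c₂
  down : ∀ {x} → x ≈ c₂ → x - + t ≈ c₁
  down x₂ = subst (_ ≈_) (sub-mul (+ toℕ i) (+ t)) (≈-+ (- + t) x₂)

  up : ∀ {x} → x ≈ c₁ → x + + t ≈ c₂
  up x₁ = subst (_ ≈_) (add-mul (+ toℕ i) (+ t)) (≈-+ (+ t) x₁)

  move : Fin s → Fin s → Point s → Point s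
  move j k p = (p [ j ]≔ (lookup p j + + t)) [ k ]≔ (lookup p k - + t)

  Present : Point s → Set
  Present p = HasResidue p c₁ × HasResidue p c₂

  present? : ∀ p → Dec (Present p)
  present? p = findCoord s p c₁ ×-dec findCoord s p c₂

  chiGen-absent : ∀ {p} → ¬ Present p → chiGen s t i p ≡ p
  chiGen-absent {p} absent with findCoord s p c₁ | findCoord s p c₂
  ... | yes h₁ | yes h₂ = ⊥-elim (absent (h₁ , h₂))
  ... | yes _  | no _   = refl
  ... | no _   | _      = refl

  chiGen-move : ∀ {p j k} → Distinct p → lookup p j ≈ c₁ → lookup p k ≈ c₂ →
                chiGen s t i p ≡ move j k p
  chiGen-move {p} {j} {k} dist pj pk with findCoord s p c₁ | findCoord s p c₂
  ... | yes (j′ , pj′) | yes (k′ , pk′) = cong₂ (λ a b → move a b p)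
        (dist j′ j (≈-trans ⟦ pj′ ⟧ (≈-sym pj))) (dist k′ k (≈-trans ⟦ pk′ ⟧ (≈-sym pk)))
  ... | yes _ | no ¬h₂ = ⊥-elim (¬h₂ (k , unwrap pk))
  ... | no ¬h₁ | _     = ⊥-elim (¬h₁ (j , unwrap pj))

  step : ℤ → ℤ
  step x with x ≈? c₂
  ... | yes _ = x - + t
  ... | no _ with x ≈? c₁
  ...   | yes _ = x + + t
  ...   | no _  = x

  -- step commutes with shifts by multiples of s, as its case split only
  -- depends on the residue of its argument
  step-shift : ∀ x {d} → + s DS.∣ d → step (x + d) ≡ step x + d
  step-shift x {d} s∣d with x + d ≈? c₂ | x ≈? c₂
  ... | yes _  | yes _  = xy∙z≈xz∙y x d (- + t)
  ... | yes h  | no ¬h  = ⊥-elim (¬h (≈-trans (≈-sym (shift-≈ x s∣d)) h))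
  ... | no ¬h  | yes h  = ⊥-elim (¬h (≈-trans (shift-≈ x s∣d) h))
  ... | no _   | no _ with x + d ≈? c₁ | x ≈? c₁
  ...   | yes _  | yes _  = xy∙z≈xz∙y x d (+ t)
  ...   | yes h  | no ¬h  = ⊥-elim (¬h (≈-trans (≈-sym (shift-≈ x s∣d)) h))
  ...   | no ¬h  | yes h  = ⊥-elim (¬h (≈-trans (shift-≈ x s∣d) h))
  ...   | no _   | no _   = refl

  step-c₂ : ∀ {x} → x ≈ c₂ → step x ≈ c₁
  step-c₂ {x} x₂ with x ≈? c₂
  ... | yes _   = down x₂
  ... | no ¬x₂  = ⊥-elim (¬x₂ x₂)

  step-c₁ : ∀ {x} → x ≈ c₁ → step x ≈ c₂
  step-c₁ {x} x₁ with x ≈? c₂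
  ... | yes x₂ = ≈-trans (down x₂) (≈-trans (≈-sym x₁) x₂)
  ... | no _ with x ≈? c₁
  ...   | yes _   = up x₁
  ...   | no ¬x₁  = ⊥-elim (¬x₁ x₁)

  step-fixed : ∀ {x} → ¬ x ≈ c₂ → ¬ x ≈ c₁ → step x ≡ x
  step-fixed {x} ¬x₂ ¬x₁ with x ≈? c₂
  ... | yes x₂ = ⊥-elim (¬x₂ x₂)
  ... | no _ with x ≈? c₁
  ...   | yes x₁ = ⊥-elim (¬x₁ x₁)
  ...   | no _   = refl

  -- the three cases of step as data, to split on without unfolding step
  classify : ∀ x → (x ≈ c₂ ⊎ x ≈ c₁) ⊎ (¬ x ≈ c₂ × ¬ x ≈ c₁)
  classify x with x ≈? c₂ | x ≈? c₁
  ... | yes x₂ | _      = inj₁ (inj₁ x₂)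
  ... | no _   | yes x₁ = inj₁ (inj₂ x₁)
  ... | no ¬x₂ | no ¬x₁ = inj₂ (¬x₂ , ¬x₁)

  step-to-c₁ : ∀ {x} → step x ≈ c₁ → x ≈ c₂
  step-to-c₁ {x} h with classify x
  ... | inj₁ (inj₁ x₂)    = x₂
  ... | inj₁ (inj₂ x₁)    = ≈-trans x₁ (≈-trans (≈-sym h) (step-c₁ x₁))
  ... | inj₂ (¬x₂ , ¬x₁)  = ⊥-elim (¬x₁ (subst (_≈ c₁) (step-fixed ¬x₂ ¬x₁) h))

  step-to-c₂ : ∀ {x} → step x ≈ c₂ → x ≈ c₁
  step-to-c₂ {x} h with classify x
  ... | inj₁ (inj₁ x₂)    = ≈-trans x₂ (≈-trans (≈-sym h) (step-c₂ x₂))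
  ... | inj₁ (inj₂ x₁)    = x₁
  ... | inj₂ (¬x₂ , ¬x₁)  = ⊥-elim (¬x₂ (subst (_≈ c₂) (step-fixed ¬x₂ ¬x₁) h))

  pinned : ∀ {x y} → x ≈ c₂ ⊎ x ≈ c₁ → step x ≈ step y → x ≈ y
  pinned (inj₁ x₂) h = ≈-trans x₂ (≈-sym (step-to-c₁ (≈-trans (≈-sym h) (step-c₂ x₂))))
  pinned (inj₂ x₁) h = ≈-trans x₁ (≈-sym (step-to-c₂ (≈-trans (≈-sym h) (step-c₁ x₁))))

  step-injective : ∀ {x y} → step x ≈ step y → x ≈ y
  step-injective {x} {y} h with classify x | classify y
  ... | inj₁ xc | _       = pinned xc h
  ... | inj₂ _  | inj₁ yc = ≈-sym (pinned yc (≈-sym h))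
  ... | inj₂ (¬x₂ , ¬x₁) | inj₂ (¬y₂ , ¬y₁) =
    subst₂ _≈_ (step-fixed ¬x₂ ¬x₁) (step-fixed ¬y₂ ¬y₁) h

  away : ∀ (p : Point s) {a b c} → ¬ lookup p a ≈ c → lookup p b ≈ c → a ≢ b
  away p ¬a pb refl = ¬a pb

  move-lookup : ∀ {p j k} → Distinct p → lookup p j ≈ c₁ → lookup p k ≈ c₂ →
                ∀ a → lookup (move j k p) a ≡ step (lookup p a)
  move-lookup {p} {j} {k} dist pj pk a with lookup p a ≈? c₂
  ... | yes a₂ with refl ← dist a k (≈-trans a₂ (≈-sym pk)) =
          lookup∘update a (p [ j ]≔ (lookup p j + + t)) _
  ... | no ¬a₂ with lookup p a ≈? c₁
  ...   | yes a₁ with refl ← dist a j (≈-trans a₁ (≈-sym pj)) =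
          trans (lookup∘update′ (away p ¬a₂ pk) (p [ a ]≔ (lookup p a + + t)) _) (lookup∘update a p _)
  ...   | no ¬a₁ = trans (lookup∘update′ (away p ¬a₂ pk) (p [ j ]≔ (lookup p j + + t)) _)
                         (lookup∘update′ (away p ¬a₁ pj) p _)

  chiGen-step : ∀ {p} → Distinct p → Present p → ∀ a → lookup (chiGen s t i p) a ≡ step (lookup p a)
  chiGen-step {p} dist ((j , pj) , (k , pk)) a =
    trans (cong (λ v → lookup v a) (chiGen-move {p} {j} {k} dist ⟦ pj ⟧ ⟦ pk ⟧))
          (move-lookup {p} {j} {k} dist ⟦ pj ⟧ ⟦ pk ⟧ a)

  chiGen-distinct : ∀ p → Distinct p → Distinct (chiGen s t i p)
  chiGen-distinct p dist with present? p
  ... | yes present = λ a b h → dist a b (step-injective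
          (subst₂ _≈_ (chiGen-step dist present a) (chiGen-step dist present b) h))
  ... | no absent = subst Distinct (sym (chiGen-absent absent)) dist

-- Every rearrangement commutes with χ_t(σ_i) on points with incongruent
-- coordinates: both sides act through step, or both act trivially.
module Commutation (s t : ℕ) (i : Fin s) where
  open Residues s
  open Rearrangements s
  open ChiGenerator s t i

  rearrangement-commutes-chiGen : ∀ {f} → Rearrangement f → ∀ p → Distinct p →
    f (chiGen s t i p) ≡ chiGen s t i (f p)
  rearrangement-commutes-chiGen {f} R p dist with present? p
  ... | yes (h₁ , h₂) = lookup-ext _ _ λ a → begin
      lookup (f (chiGen s t i p)) a
        ≡⟨ commutes-pointwise R step step-shift p _ (chiGen-step dist (h₁ , h₂)) a ⟩
      step (lookup (f p) a)
        ≡⟨ chiGen-step (preserves-distinct R p dist) present-image a ⟨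
      lookup (chiGen s t i (f p)) a ∎
    where
    open ≡-Reasoning
    present-image : Present (f p)
    present-image = residue-image R p c₁ h₁ , residue-image R p c₂ h₂
  ... | no absent =
    trans (cong f (chiGen-absent absent)) (sym (chiGen-absent (absent ∘ present-source)))
    where
    present-source : Present (f p) → Present p
    present-source (h₁ , h₂) = residue-source R p c₁ h₁ , residue-source R p c₂ h₂

psi-chi-commute : ∀ m t → let s = suc (suc m) in
  ∀ σ τ p → Residues.Distinct s p → psi s t σ (chi s t τ p) ≡ chi s t τ (psi s t σ p)
psi-chi-commute m t = act-commute
  (λ g → preserves-distinct (psiGen-rearrangement m t g))
  (λ i → ChiGenerator.chiGen-distinct s t i)
  (λ g i → Commutation.rearrangement-commutes-chiGen s t i (psiGen-rearrangement m t g))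
  where
  s = suc (suc m)
  open Words (Residues.Distinct s)
  open Rearrangements s

module _ (s : ℕ) .{{_ : ℕ.NonZero s}} where
  open Congruence s

  congruent-ordered : ∀ {x y} → x ℕ.≤ y → y ℕ.< s → + x ≈ + y → x ≡ y
  congruent-ordered {x} {y} x≤y y<s h = ℕP.≤-antisym x≤y (ℕP.m∸n≡0⇒m≤n gap≡0)
    where
    gap : ∣ + x - + y ∣ ≡ y ℕ.∸ x
    gap = trans (cong ∣_∣ (ℤP.m-n≡m⊖n x y)) (ℤP.∣⊖∣-≤ x≤y)

    -- y ∸ x is a multiple of s smaller than s
    gap≡0 : y ℕ.∸ x ≡ 0
    gap≡0 = trans (sym (m<n⇒m%n≡m (ℕP.≤-<-trans (ℕP.m∸n≤m y x) y<s)))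
                  (ℕD.n∣m⇒m%n≡0 _ s (subst (s ℕD.∣_) gap (unwrap h)))

  congruent-below : ∀ {x y} → x ℕ.< s → y ℕ.< s → + x ≈ + y → x ≡ y
  congruent-below {x} {y} x<s y<s h with ℕP.≤-total x y
  ... | inj₁ x≤y = congruent-ordered x≤y y<s h
  ... | inj₂ y≤x = sym (congruent-ordered y≤x x<s (≈-sym h))

origin-lookup : ∀ s a → lookup (origin s) a ≡ + toℕ a
origin-lookup s a = lookup∘tabulate (λ b → + toℕ b) a

origin-distinct : ∀ s → Residues.Distinct s (origin s)
origin-distinct zero    () _ _
origin-distinct (suc n) a b h = FP.toℕ-injective
  (congruent-below (suc n) (FP.toℕ<n a) (FP.toℕ<n b)
    (subst₂ (Congruence._≈_ (suc n)) (origin-lookup _ a) (origin-lookup _ b) h))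

-- Part (2): at the origin, with t = 1, ψ_1(σ_i) and χ_1(σ_i) agree.
-- χ_1(σ_i) raises the coordinate equal to i-1 (mod s) and lowers the one equal
-- to i; at the origin these are the coordinates exchanged by ψ_1(σ_i).
module OriginAgreement (m : ℕ) where
  s : ℕ
  s = suc (suc m)

  O : Point s
  O = origin s

  last : Fin s
  last = fromℕ (suc m)

  open Congruence s

  private
    below-zero : ∀ x → + 0 - + 1 ≡ (+ 1 + x) - (+ 2 + x) * + 1
    below-zero = solve-∀

    wrap-around : ∀ x → (+ 1 + x) + + 1 ≡ + 0 + (+ 2 + x) * + 1
    wrap-around = solve-∀

    predecessor : ∀ x → x ≡ ((+ 1 + x) - + 1) * + 1
    predecessor = solve-∀

    decrement : ∀ x → x ≡ (+ 1 + x) - + 1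
    decrement = solve-∀

  last-value : lookup O last ≡ + suc m
  last-value = trans (origin-lookup s last) (cong +_ (FP.toℕ-fromℕ (suc m)))

  -- σ_0: χ raises the last coordinate s-1 ≡ -1 and lowers the first one, 0;
  -- ψ exchanges them, shifting by s
  agree-zero : psiGen s 1 Fin.zero O ≡ chiGen s 1 Fin.zero O
  agree-zero = begin
    psiGen s 1 Fin.zero O
      ≡⟨ cong₂ (λ u v → (O [ Fin.zero ]≔ u) [ last ]≔ v)
           (trans (cong (λ x → x - + s * + 1) last-value) (sym (below-zero (+ m))))
           (trans (sym (wrap-around (+ m))) (cong (_+ + 1) (sym last-value))) ⟩
    (O [ Fin.zero ]≔ (lookup O Fin.zero - + 1)) [ last ]≔ (lookup O last + + 1)
      ≡⟨ []≔-commutes O last Fin.zero (λ ()) ⟨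
    move last Fin.zero O
      ≡⟨ chiGen-move {O} {last} {Fin.zero} (origin-distinct s) last≈c₁ ≈-refl ⟨
    chiGen s 1 Fin.zero O ∎
    where
    open ≡-Reasoning
    open ChiGenerator s 1 Fin.zero
    last≈c₁ : lookup O last ≈ c₁
    last≈c₁ = ≈-trans (≈-reflexive last-value)
                ⟦ subst (s ℕD.∣_) (cong suc (ℕP.+-comm 1 m)) ℕD.∣-refl ⟧

  -- σ_{i+1}: χ raises the coordinate i and lowers i+1; ψ swaps them
  agree-suc : ∀ i → psiGen s 1 (Fin.suc i) O ≡ chiGen s 1 (Fin.suc i) O
  agree-suc i = begin
    swap (inject₁ i) (Fin.suc i) O
      ≡⟨ cong₂ (λ u v → (O [ inject₁ i ]≔ u) [ Fin.suc i ]≔ v)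
           (trans (cong (_+ + 1) lower-value) (trans (ℤP.+-comm (+ n) (+ 1)) (sym upper-value)))
           (trans (cong (_- + 1) upper-value) (trans (sym (decrement (+ n))) (sym lower-value))) ⟨
    move (inject₁ i) (Fin.suc i) O
      ≡⟨ chiGen-move {O} {inject₁ i} {Fin.suc i} (origin-distinct s) lower≈c₁ upper≈c₂ ⟨
    chiGen s 1 (Fin.suc i) O ∎
    where
    open ≡-Reasoning
    open ChiGenerator s 1 (Fin.suc i)
    n : ℕ
    n = toℕ i
    lower-value : lookup O (inject₁ i) ≡ + n
    lower-value = trans (origin-lookup s (inject₁ i)) (cong +_ (FP.toℕ-inject₁ i))
    upper-value : lookup O (Fin.suc i) ≡ + suc n
    upper-value = origin-lookup s (Fin.suc i)
    lower≈c₁ : lookup O (inject₁ i) ≈ c₁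
    lower≈c₁ = ≈-reflexive (trans lower-value (predecessor (+ n)))
    upper≈c₂ : lookup O (Fin.suc i) ≈ c₂
    upper≈c₂ = ≈-reflexive (trans upper-value (sym (ℤP.*-identityʳ (+ suc n))))

  agree : ∀ g → psiGen s 1 g O ≡ chiGen s 1 g O
  agree Fin.zero    = agree-zero
  agree (Fin.suc i) = agree-suc i

lemma3p2 : (s t : ℕ) → 2 ≤ s → 1 ≤ t → Coprime s t →
    ((σ τ : Word s) (p : Point s) → IsSPoint s p →
        psi s t σ (chi s t τ p) ≡ chi s t τ (psi s t σ p))
    × (t ≡ 1 → (i : Fin s) → psiGen s 1 i (origin s) ≡ chiGen s 1 i (origin s))
lemma3p2 (suc zero) t (ℕ.s≤s ()) _ _
lemma3p2 (suc (suc m)) t _ _ _ =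
  (λ σ τ p sp → psi-chi-commute m t σ τ p (Residues.spoint-distinct _ p sp)) ,
  (λ _ → OriginAgreement.agree m)
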